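{- Let $0<\epsilon<1/16$. There is $N=N(\epsilon)$ such that for every connected unweighted graph $G=(V,E)$ with $n=|V|\ge N$, a random cut $S$ (each vertex included independently with probability $1/2$) satisfies $\mathbb{E}[\varphi(S)]\ge(\frac12-\epsilon)\max_{S'\subseteq V}\varphi(S')$; i.e., $S$ is a $(1/2-\epsilon)$-approximation for fault tolerant Max-Cut against an adaptive adversary with a single fault.
   Context: For $S\subseteq V$, $C_{S,G}$ is the number of edges with exactly one endpoint in $S$; $G-\{v\}$ deletes $v$ and its incident edges; $\varphi(S)=\min_{v\in V}C_{S-\{v\},G-\{v\}}$.
   Formalization: The parameter ε ranges over the rationals with $0<\epsilon<1/16$. -}

module Defs where

open import Data.Bool using (Bool; true; false; _∧_; not; if_then_else_)
open import Data.Nat using (ℕ; zero; suc; _+_; _^_; _⊓_; _⊔_)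
open import Data.Nat.Properties using (m^n≢0)
open import Data.Fin using (Fin; zero; suc; punchIn)
open import Data.List using (List; []; _∷_; map; foldr; allFin; _++_)
open import Data.Nat.ListAction using (sum)
open import Data.Integer using (+_)
open import Data.Rational using (ℚ; _/_)
open import Relation.Binary.PropositionalEquality using (_≡_)

record Graph (n : ℕ) : Set where
  field
    adj    : Fin n → Fin n → Bool
    sym    : ∀ u v → adj u v ≡ adj v u
    irrefl : ∀ v → adj v v ≡ false
open Graph public

data Reach {n : ℕ} (G : Graph n) : Fin n → Fin n → Set where
  here : ∀ {v} → Reach G v v
  step : ∀ {u w v} → adj G u w ≡ true → Reach G w v → Reach G u v

Connected : {n : ℕ} → Graph n → Set
Connected {n} G = (u v : Fin n) → Reach G u v

Subset : ℕ → Set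
Subset n = Fin n → Bool

allSubsets : (n : ℕ) → List (Subset n)
allSubsets zero = (λ ()) ∷ []
allSubsets (suc n) =
  map (λ S → λ { zero → false ; (suc i) → S i }) (allSubsets n)
  ++ map (λ S → λ { zero → true ; (suc i) → S i }) (allSubsets n)

-- C_{S,G}: number of edges with exactly one endpoint in S
-- (each such edge {u,w} counted once, oriented with u ∈ S, w ∉ S).
cutSize : {n : ℕ} → Graph n → Subset n → ℕ
cutSize {n} G S =
  sum (map (λ u → sum (map (λ w →
    if S u ∧ not (S w) ∧ adj G u w then 1 else 0) (allFin n))) (allFin n))

deleteVertex : {m : ℕ} → Graph (suc m) → Fin (suc m) → Graph m
deleteVertex G v = record
  { adj    = λ i j → adj G (punchIn v i) (punchIn v j)
  ; sym    = λ i j → sym G (punchIn v i) (punchIn v j)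
  ; irrefl = λ i → irrefl G (punchIn v i)
  }

removeFromSubset : {m : ℕ} → Subset (suc m) → Fin (suc m) → Subset m
removeFromSubset S v = λ i → S (punchIn v i)

-- φ(S) = min_{v ∈ V} C_{S - {v}, G - {v}}  (defined as 0 for the empty graph).
φ : {n : ℕ} → Graph n → Subset n → ℕ
φ {zero} G S = 0
φ {suc m} G S =
  foldr _⊓_ (f zero) (map f (allFin (suc m)))
  where
    f : Fin (suc m) → ℕ
    f v = cutSize (deleteVertex G v) (removeFromSubset S v)

maxφ : {n : ℕ} → Graph n → ℕ
maxφ {n} G = foldr _⊔_ 0 (map (φ G) (allSubsets n))

-- E[φ(S)] for S uniformly random (each vertex independently w.p. 1/2):
-- (Σ_{S ⊆ V} φ(S)) / 2^n.
expectedφ : {n : ℕ} → Graph n → ℚ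
expectedφ {n} G = _/_ (+ sum (map (φ G) (allSubsets n))) (2 ^ n) {{m^n≢0 2 n}}

-- Let u be a vertex of maximum degree Δ and D = 2|E(G - u)|. Every φ(S) is at most the cut
-- C_{S-u,G-u} ≤ D/2, so max φ ≤ D/2, while a random S cuts G - u in D/4 edges on average.
-- Deleting v removes exactly its crossing degree c_v(S) from the cut of G, hence
-- φ(S) = C_{S-u,G-u} - max_v (c_v(S) - c_u(S)), and it remains to bound the expected deficit
-- max_v (c_v(S) - c_u(S)) by a 2/k fraction of D/4, where 1/k ≤ ε. Connectivity gives Δ + D ≥ n - 1.
-- If 4D ≤ Δ, then Δ is large; a deficit needs c_u(S) ≤ D ≤ Δ/4 (deleting any v ≠ u keeps all but one
-- of the edges at u cut), and since c_u(S) is Bin(Δ, 1/2) Chebyshev makes this unlikely.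
-- Otherwise D is large, and AM–GM bounds the deficit by squared deviations |deg v - 2c_v(S)|²,
-- whose expectations deg v add up to 2|E| = 2Δ + D.
module Submission where

open import Defs hiding (sym)

-- The counting argument is kept in this block so that the arithmetic of ℕ opened here does not
-- clash with the arithmetic of ℚ in the statement of the theorem.
module _ where

  open import Data.Bool using (Bool; true; false; _∧_; not; _xor_; if_then_else_)
  open import Data.Nat
  open import Data.Nat.Properties
  open import Data.Nat.ListAction using () renaming (sum to listSum)
  open import Data.Nat.ListAction.Properties using (sum-++)
  open import Data.Nat.Tactic.RingSolver using (solve-∀)
  open import Data.Fin using (Fin; zero; suc; punchIn; punchOut) renaming (_≟_ to _≟ᶠ_)
  open import Data.Fin.Properties using (punchInᵢ≢i; punchIn-injective; punchIn-punchOut)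
  open import Data.List using (List; []; _∷_; _++_; map; foldr; allFin; tabulate)
  open import Data.List.Properties using (map-tabulate; map-++; map-∘)
  open import Data.List.Membership.Propositional using (_∈_)
  open import Data.List.Membership.Propositional.Properties using (foldr-selective; ∈-map⁺; ∈-map⁻; ∈-allFin)
  open import Data.List.Relation.Unary.Any using (here; there)
  import Data.List.Relation.Unary.All as All
  open import Data.List.Extrema.Nat using (argmax; f[xs]≤f[argmax])
  open import Algebra.Definitions using (Selective)
  open import Data.Product using (∃-syntax; _×_; _,_)
  open import Data.Sum using (_⊎_; inj₁; inj₂; map₂; [_,_]′)
  open import Function using (_∘_; flip)
  open import Relation.Binary.PropositionalEquality
  open import Relation.Nullary using (Dec; yes; no; does; contradiction)
  open import Relation.Nullary.Decidable using (dec-true; dec-false)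
  open import Algebra.Properties.CommutativeMonoid.Sum +-0-commutativeMonoid
    using (sum; sum-syntax; sum-cong-≗; sum-remove; ∑-distrib-+; ∑-comm; sum-replicate-zero)
  open import Algebra.Properties.Semiring.Sum +-*-semiring using (*-distribˡ-sum; *-distribʳ-sum)

  -- Arithmetic

  infixl 8 _²
  _² : ℕ → ℕ
  n ² = n * n

  indicator : Bool → ℕ
  indicator b = if b then 1 else 0

  indicator≤1 : ∀ b → indicator b ≤ 1
  indicator≤1 true = ≤-refl
  indicator≤1 false = z≤n

  indicator-*-≤ : ∀ a b → indicator a * indicator b ≤ indicator a
  indicator-*-≤ true b = ≤-trans (≤-reflexive (+-identityʳ (indicator b))) (indicator≤1 b)
  indicator-*-≤ false b = z≤n

  indicator-idem : ∀ b → indicator b * indicator b ≡ indicator b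
  indicator-idem true = refl
  indicator-idem false = refl

  -- Rewrites an indicator of three coordinates through indicators of two, which ∑ₛ-coordinates averages.
  xor-xor-identity : ∀ x y z → 2 * (indicator (x xor y) * indicator (x xor z)) + 1
                               ≡ indicator (not (y xor z)) + indicator (x xor y) + indicator (x xor z)
  xor-xor-identity true  true  true  = refl
  xor-xor-identity true  true  false = refl
  xor-xor-identity true  false true  = refl
  xor-xor-identity true  false false = refl
  xor-xor-identity false true  true  = refl
  xor-xor-identity false true  false = refl
  xor-xor-identity false false true  = refl
  xor-xor-identity false false false = refl

  scale-or-vanish : ∀ k a X p → a ≡ 0 ⊎ k * X ≡ p → k * (a * X) ≡ a * p
  scale-or-vanish k .0 X p (inj₁ refl) = *-zeroʳ k
  scale-or-vanish k a X p (inj₂ kX≡p) = trans (swap k a X) (cong (a *_) kX≡p)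
    where
    swap : ∀ k a x → k * (a * x) ≡ a * (k * x)
    swap = solve-∀

  ∣m-n∣²+2mn≡m²+n² : ∀ m n → ∣ m - n ∣ ² + 2 * m * n ≡ m ² + n ²
  ∣m-n∣²+2mn≡m²+n² m n = [ ordered , flipped ]′ (≤-total m n)
    where
    ordered : ∀ {m n} → m ≤ n → ∣ m - n ∣ ² + 2 * m * n ≡ m ² + n ²
    ordered {m} {n} m≤n rewrite sym (m+[n∸m]≡n m≤n) | ∣m-m+n∣≡n m (n ∸ m) = identity m (n ∸ m)
      where
      identity : ∀ m k → k * k + 2 * m * (m + k) ≡ m * m + (m + k) * (m + k)
      identity = solve-∀
    swap : ∀ m n → 2 * m * n ≡ 2 * n * m
    swap = solve-∀
    flipped : n ≤ m → ∣ m - n ∣ ² + 2 * m * n ≡ m ² + n ²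
    flipped n≤m = begin
      ∣ m - n ∣ ² + 2 * m * n ≡⟨ cong₂ (λ d p → d ² + p) (∣-∣-comm m n) (swap m n) ⟩
      ∣ n - m ∣ ² + 2 * n * m ≡⟨ ordered n≤m ⟩
      n ² + m ²              ≡⟨ +-comm (n ²) (m ²) ⟩
      m ² + n ²              ∎
      where open ≡-Reasoning

  2mn≤m²+n² : ∀ m n → 2 * m * n ≤ m ² + n ²
  2mn≤m²+n² m n = subst (2 * m * n ≤_) (∣m-n∣²+2mn≡m²+n² m n) (m≤n+m _ _)

  Δ²≤4∣Δ-2c∣² : ∀ Δ c → 4 * c ≤ Δ → Δ ² ≤ 4 * ∣ Δ - 2 * c ∣ ²
  Δ²≤4∣Δ-2c∣² Δ c 4c≤Δ = begin
    Δ ²                     ≤⟨ *-mono-≤ Δ≤2x Δ≤2x ⟩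
    (x + x) * (x + x)       ≡⟨ double² x ⟩
    4 * x ²                 ∎
    where
    open ≤-Reasoning
    x = ∣ Δ - 2 * c ∣
    2c+2c≤Δ : 2 * c + 2 * c ≤ Δ
    2c+2c≤Δ = ≤-trans (≤-reflexive (quadruple c)) 4c≤Δ
      where
      quadruple : ∀ c → 2 * c + 2 * c ≡ 4 * c
      quadruple = solve-∀
    2c≤x : 2 * c ≤ x
    2c≤x = subst (2 * c ≤_) (sym (m≤n⇒∣n-m∣≡n∸m (m+n≤o⇒m≤o (2 * c) 2c+2c≤Δ))) (m+n≤o⇒m≤o∸n (2 * c) 2c+2c≤Δ)
    Δ≤2x : Δ ≤ x + x
    Δ≤2x = ≤-trans (m≤∣m-n∣+n Δ (2 * c)) (+-monoʳ-≤ x 2c≤x)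
    double² : ∀ x → (x + x) * (x + x) ≡ 4 * (x * x)
    double² = solve-∀

  -- As d ≤ Δ, the loss 2(c′ - c) is at most |d - 2c′| + |Δ - 2c|; then 2tx ≤ t² + x² (AM–GM).
  exchange-bound : ∀ t {y y′ c c′ d Δ} → y + c ≡ y′ + c′ → d ≤ Δ →
                   4 * t * y ≤ 4 * t * y′ + (2 * t ² + ∣ d - 2 * c′ ∣ ² + ∣ Δ - 2 * c ∣ ²)
  exchange-bound t {y} {y′} {c} {c′} {d} {Δ} y+c≡y′+c′ d≤Δ = +-cancelʳ-≤ (4 * t * c) _ _ (begin
    4 * t * y + 4 * t * c   ≡⟨ sym (*-distribˡ-+ (4 * t) y c) ⟩
    4 * t * (y + c)         ≡⟨ cong (4 * t *_) y+c≡y′+c′ ⟩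
    4 * t * (y′ + c′)       ≡⟨ *-distribˡ-+ (4 * t) y′ c′ ⟩
    4 * t * y′ + 4 * t * c′ ≤⟨ +-monoʳ-≤ (4 * t * y′) 4tc′≤ ⟩
    4 * t * y′ + (4 * t * c + R) ≡⟨ shuffle (4 * t * y′) (4 * t * c) R ⟩
    4 * t * y′ + R + 4 * t * c ∎)
    where
    open ≤-Reasoning
    x = ∣ d - 2 * c′ ∣
    w = ∣ Δ - 2 * c ∣
    R = 2 * t ² + x ² + w ²
    2c′≤2c+w+x : 2 * c′ ≤ 2 * c + w + x
    2c′≤2c+w+x = begin
      2 * c′                  ≤⟨ m≤n+∣m-n∣ (2 * c′) d ⟩
      d + ∣ 2 * c′ - d ∣      ≡⟨ cong (d +_) (∣-∣-comm (2 * c′) d) ⟩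
      d + x                   ≤⟨ +-monoˡ-≤ x d≤Δ ⟩
      Δ + x                   ≤⟨ +-monoˡ-≤ x (m≤n+∣m-n∣ Δ (2 * c)) ⟩
      2 * c + w + x           ∎
    4tc′≤ : 4 * t * c′ ≤ 4 * t * c + R
    4tc′≤ = begin
      4 * t * c′                          ≡⟨ regroup t c′ ⟩
      2 * t * (2 * c′)                    ≤⟨ *-monoʳ-≤ (2 * t) 2c′≤2c+w+x ⟩
      2 * t * (2 * c + w + x)             ≡⟨ expand t c w x ⟩
      4 * t * c + (2 * t * w + 2 * t * x) ≤⟨ +-monoʳ-≤ (4 * t * c) (+-mono-≤ (2mn≤m²+n² t w) (2mn≤m²+n² t x)) ⟩
      4 * t * c + ((t ² + w ²) + (t ² + x ²)) ≡⟨ cong (4 * t * c +_) (collect (t * t) (w * w) (x * x)) ⟩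
      4 * t * c + R                       ∎
      where
      regroup : ∀ t c → 4 * t * c ≡ 2 * t * (2 * c)
      regroup = solve-∀
      expand : ∀ t c w x → 2 * t * (2 * c + w + x) ≡ 4 * t * c + (2 * t * w + 2 * t * x)
      expand = solve-∀
      collect : ∀ a b c → (a + b) + (a + c) ≡ 2 * a + c + b
      collect = solve-∀
    shuffle : ∀ a b c → a + (b + c) ≡ a + c + b
    shuffle = solve-∀

  [2+j]x≤y+2x⇒jx≤y : ∀ j {x y} → (2 + j) * x ≤ y + 2 * x → j * x ≤ y
  [2+j]x≤y+2x⇒jx≤y j {x} {y} le = +-cancelʳ-≤ (2 * x) _ _ (begin
    j * x + 2 * x ≡⟨ +-comm (j * x) (2 * x) ⟩
    2 * x + j * x ≡⟨ sym (*-distribʳ-+ x 2 j) ⟩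
    (2 + j) * x   ≤⟨ le ⟩
    y + 2 * x     ∎)
    where open ≤-Reasoning

  -- Finite sums

  ∑-allFin : ∀ {n} (f : Fin n → ℕ) → listSum (map f (allFin n)) ≡ ∑[ i < n ] f i
  ∑-allFin f = trans (cong listSum (map-tabulate (λ i → i) f)) (listSum-tabulate f)
    where
    listSum-tabulate : ∀ {n} (g : Fin n → ℕ) → listSum (tabulate g) ≡ ∑[ i < n ] g i
    listSum-tabulate {zero} g = refl
    listSum-tabulate {suc n} g = cong (g zero +_) (listSum-tabulate (g ∘ suc))

  ∑-mono-≤ : ∀ {n} {f g : Fin n → ℕ} → (∀ i → f i ≤ g i) → ∑[ i < n ] f i ≤ ∑[ i < n ] g i
  ∑-mono-≤ {zero} f≤g = z≤n
  ∑-mono-≤ {suc n} f≤g = +-mono-≤ (f≤g zero) (∑-mono-≤ (f≤g ∘ suc))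

  ∑-const : ∀ n c → ∑[ i < n ] c ≡ n * c
  ∑-const zero c = refl
  ∑-const (suc n) c = cong (c +_) (∑-const n c)

  summand≤∑ : ∀ {n} (f : Fin n → ℕ) i → f i ≤ ∑[ j < n ] f j
  summand≤∑ {suc n} f i = ≤-trans (m≤m+n (f i) _) (≤-reflexive (sym (sum-remove {i = i} f)))

  ∑-*ˡ : ∀ {n} c (f : Fin n → ℕ) → ∑[ i < n ] (c * f i) ≡ c * ∑[ i < n ] f i
  ∑-*ˡ c f = sym (*-distribˡ-sum c f)

  ∑*∑ : ∀ {n} (f g : Fin n → ℕ) → ∑[ i < n ] f i * ∑[ j < n ] g j ≡ ∑[ i < n ] ∑[ j < n ] (f i * g j)
  ∑*∑ f g = trans (*-distribʳ-sum (sum g) f) (sum-cong-≗ (λ i → *-distribˡ-sum (f i) g))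

  ∑-indicator-≡ : ∀ {n} (g : Fin n → ℕ) b → ∑[ c < n ] (g c * indicator (does (b ≟ᶠ c))) ≡ g b
  ∑-indicator-≡ {suc n} g b = begin
    ∑[ c < suc n ] (g c * indicator (does (b ≟ᶠ c)))
      ≡⟨ sum-remove {i = b} (λ c → g c * indicator (does (b ≟ᶠ c))) ⟩
    g b * indicator (does (b ≟ᶠ b)) + ∑[ i < n ] (g (punchIn b i) * indicator (does (b ≟ᶠ punchIn b i)))
      ≡⟨ cong₂ _+_ (cong (λ x → g b * indicator x) (dec-true (b ≟ᶠ b) refl))
                   (sum-cong-≗ λ i → cong (λ x → g (punchIn b i) * indicator x)
                                           (dec-false (b ≟ᶠ punchIn b i) (punchInᵢ≢i b i ∘ sym))) ⟩
    g b * 1 + ∑[ i < n ] (g (punchIn b i) * 0)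
      ≡⟨ cong₂ _+_ (*-identityʳ (g b))
                   (trans (sum-cong-≗ λ i → *-zeroʳ (g (punchIn b i))) (sum-replicate-zero n)) ⟩
    g b + 0
      ≡⟨ +-identityʳ (g b) ⟩
    g b ∎
    where open ≡-Reasoning

  sumOver : {A : Set} → List A → (A → ℕ) → ℕ
  sumOver xs f = listSum (map f xs)

  module _ {A : Set} where

    sumOver-cong : ∀ (xs : List A) {f g : A → ℕ} → (∀ x → f x ≡ g x) → sumOver xs f ≡ sumOver xs g
    sumOver-cong [] f≡g = refl
    sumOver-cong (x ∷ xs) f≡g = cong₂ _+_ (f≡g x) (sumOver-cong xs f≡g)

    sumOver-mono-≤ : ∀ (xs : List A) {f g : A → ℕ} → (∀ x → f x ≤ g x) → sumOver xs f ≤ sumOver xs g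
    sumOver-mono-≤ [] f≤g = z≤n
    sumOver-mono-≤ (x ∷ xs) f≤g = +-mono-≤ (f≤g x) (sumOver-mono-≤ xs f≤g)

    sumOver-distrib-+ : ∀ (xs : List A) (f g : A → ℕ) →
                        sumOver xs (λ x → f x + g x) ≡ sumOver xs f + sumOver xs g
    sumOver-distrib-+ [] f g = refl
    sumOver-distrib-+ (x ∷ xs) f g = begin
      (f x + g x) + sumOver xs (λ x → f x + g x)  ≡⟨ cong (f x + g x +_) (sumOver-distrib-+ xs f g) ⟩
      (f x + g x) + (sumOver xs f + sumOver xs g) ≡⟨ +-+-comm (f x) (g x) _ _ ⟩
      (f x + sumOver xs f) + (g x + sumOver xs g) ∎
      where
      open ≡-Reasoning
      +-+-comm : ∀ a b c d → (a + b) + (c + d) ≡ (a + c) + (b + d)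
      +-+-comm = solve-∀

    sumOver-*ˡ : ∀ (xs : List A) c (f : A → ℕ) → sumOver xs (λ x → c * f x) ≡ c * sumOver xs f
    sumOver-*ˡ [] c f = sym (*-zeroʳ c)
    sumOver-*ˡ (x ∷ xs) c f =
      trans (cong (c * f x +_) (sumOver-*ˡ xs c f)) (sym (*-distribˡ-+ c (f x) _))

    sumOver-∑ : ∀ (xs : List A) {n} (f : A → Fin n → ℕ) →
                sumOver xs (λ x → ∑[ i < n ] f x i) ≡ ∑[ i < n ] sumOver xs (λ x → f x i)
    sumOver-∑ [] {n} f = sym (sum-replicate-zero n)
    sumOver-∑ (x ∷ xs) f =
      trans (cong (sum (f x) +_) (sumOver-∑ xs f)) (sym (∑-distrib-+ (f x) _))

    sumOver-map-++ : ∀ {B : Set} (xs : List A) (g h : A → B) (F : B → ℕ) →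
                     sumOver (map g xs ++ map h xs) F ≡ sumOver xs (F ∘ g) + sumOver xs (F ∘ h)
    sumOver-map-++ xs g h F = begin
      listSum (map F (map g xs ++ map h xs))
        ≡⟨ cong listSum (map-++ F (map g xs) (map h xs)) ⟩
      listSum (map F (map g xs) ++ map F (map h xs))
        ≡⟨ sum-++ (map F (map g xs)) _ ⟩
      listSum (map F (map g xs)) + listSum (map F (map h xs))
        ≡⟨ sym (cong₂ _+_ (cong listSum (map-∘ xs)) (cong listSum (map-∘ xs))) ⟩
      sumOver xs (F ∘ g) + sumOver xs (F ∘ h) ∎
      where open ≡-Reasoning

  -- Sums over all subsets

  -- ∑ₛ n F = 2ⁿ · E[F(S)] for a uniformly random S ⊆ Fin n.
  ∑ₛ : (n : ℕ) → (Subset n → ℕ) → ℕ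
  ∑ₛ n = sumOver (allSubsets n)

  ∑ₛ-const : ∀ n c → ∑ₛ n (λ _ → c) ≡ 2 ^ n * c
  ∑ₛ-const zero c = refl
  ∑ₛ-const (suc n) c = begin
    ∑ₛ (suc n) (λ _ → c)            ≡⟨ sumOver-map-++ (allSubsets n) _ _ (λ _ → c) ⟩
    ∑ₛ n (λ _ → c) + ∑ₛ n (λ _ → c) ≡⟨ cong₂ _+_ (∑ₛ-const n c) (∑ₛ-const n c) ⟩
    2 ^ n * c + 2 ^ n * c           ≡⟨ double (2 ^ n) c ⟩
    2 ^ suc n * c                   ∎
    where
    open ≡-Reasoning
    double : ∀ p c → p * c + p * c ≡ (2 * p) * c
    double = solve-∀

  ∑ₛ-coordinate : ∀ n (a : Fin n) (h : Bool → ℕ) →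
                  2 * ∑ₛ n (λ S → h (S a)) ≡ 2 ^ n * (h true + h false)
  ∑ₛ-coordinate (suc n) zero h = begin
    2 * ∑ₛ (suc n) (λ S → h (S zero))
      ≡⟨ cong (2 *_) (sumOver-map-++ (allSubsets n) _ _ (λ S → h (S zero))) ⟩
    2 * (∑ₛ n (λ _ → h false) + ∑ₛ n (λ _ → h true))
      ≡⟨ cong (2 *_) (cong₂ _+_ (∑ₛ-const n (h false)) (∑ₛ-const n (h true))) ⟩
    2 * (2 ^ n * h false + 2 ^ n * h true)
      ≡⟨ rearrange (2 ^ n) (h true) (h false) ⟩
    2 ^ suc n * (h true + h false) ∎
    where
    open ≡-Reasoning
    rearrange : ∀ p x y → 2 * (p * y + p * x) ≡ (2 * p) * (x + y)
    rearrange = solve-∀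
  ∑ₛ-coordinate (suc n) (suc a) h = begin
    2 * ∑ₛ (suc n) (λ S → h (S (suc a)))
      ≡⟨ cong (2 *_) (sumOver-map-++ (allSubsets n) _ _ (λ S → h (S (suc a)))) ⟩
    2 * (X + X)                    ≡⟨ cong (2 *_) (cong (X +_) (sym (+-identityʳ X))) ⟩
    2 * (2 * X)                    ≡⟨ cong (2 *_) (∑ₛ-coordinate n a h) ⟩
    2 * (2 ^ n * (h true + h false)) ≡⟨ sym (*-assoc 2 (2 ^ n) _) ⟩
    2 ^ suc n * (h true + h false) ∎
    where
    open ≡-Reasoning
    X = ∑ₛ n (λ S → h (S a))

  ∑𝔹² : (Bool → Bool → ℕ) → ℕ
  ∑𝔹² g = g true true + g true false + g false true + g false false

  ∑ₛ-first-coordinates : ∀ n b (g : Bool → Bool → ℕ) →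
                         4 * ∑ₛ (suc n) (λ S → g (S zero) (S (suc b))) ≡ 2 ^ suc n * ∑𝔹² g
  ∑ₛ-first-coordinates n b g = begin
    4 * ∑ₛ (suc n) (λ S → g (S zero) (S (suc b)))
      ≡⟨ cong (4 *_) (sumOver-map-++ (allSubsets n) _ _ (λ S → g (S zero) (S (suc b)))) ⟩
    4 * (∑ₛ n (λ S → g false (S b)) + ∑ₛ n (λ S → g true (S b)))
      ≡⟨ split (∑ₛ n (λ S → g false (S b))) _ ⟩
    2 * (2 * ∑ₛ n (λ S → g false (S b))) + 2 * (2 * ∑ₛ n (λ S → g true (S b)))
      ≡⟨ cong₂ _+_ (cong (2 *_) (∑ₛ-coordinate n b (g false))) (cong (2 *_) (∑ₛ-coordinate n b (g true))) ⟩
    2 * (2 ^ n * (g false true + g false false)) + 2 * (2 ^ n * (g true true + g true false))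
      ≡⟨ collect (2 ^ n) (g true true) (g true false) (g false true) (g false false) ⟩
    2 ^ suc n * ∑𝔹² g ∎
    where
    open ≡-Reasoning
    split : ∀ x y → 4 * (x + y) ≡ 2 * (2 * x) + 2 * (2 * y)
    split = solve-∀
    collect : ∀ p a b c d → 2 * (p * (c + d)) + 2 * (p * (a + b)) ≡ (2 * p) * (a + b + c + d)
    collect = solve-∀

  ∑ₛ-coordinates : ∀ n {a b : Fin n} → a ≢ b → (g : Bool → Bool → ℕ) →
                   4 * ∑ₛ n (λ S → g (S a) (S b)) ≡ 2 ^ n * ∑𝔹² g
  ∑ₛ-coordinates (suc n) {zero} {zero} 0≢0 g = contradiction refl 0≢0
  ∑ₛ-coordinates (suc n) {zero} {suc b} _ g = ∑ₛ-first-coordinates n b g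
  ∑ₛ-coordinates (suc n) {suc a} {zero} _ g =
    trans (∑ₛ-first-coordinates n a (flip g)) (cong (2 ^ suc n *_) (∑𝔹²-flip g))
    where
    swap-middle : ∀ a b c d → a + c + b + d ≡ a + b + c + d
    swap-middle = solve-∀
    ∑𝔹²-flip : ∀ g → ∑𝔹² (flip g) ≡ ∑𝔹² g
    ∑𝔹²-flip g = swap-middle (g true true) (g true false) (g false true) (g false false)
  ∑ₛ-coordinates (suc n) {suc a} {suc b} sa≢sb g = begin
    4 * ∑ₛ (suc n) (λ S → g (S (suc a)) (S (suc b)))
      ≡⟨ cong (4 *_) (sumOver-map-++ (allSubsets n) _ _ (λ S → g (S (suc a)) (S (suc b)))) ⟩
    4 * (X + X)           ≡⟨ twice X ⟩
    2 * (4 * X)           ≡⟨ cong (2 *_) (∑ₛ-coordinates n (sa≢sb ∘ cong suc) g) ⟩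
    2 * (2 ^ n * ∑𝔹² g)  ≡⟨ sym (*-assoc 2 (2 ^ n) _) ⟩
    2 ^ suc n * ∑𝔹² g    ∎
    where
    open ≡-Reasoning
    X = ∑ₛ n (λ S → g (S a) (S b))
    twice : ∀ x → 4 * (x + x) ≡ 2 * (4 * x)
    twice = solve-∀

  ∑ₛ-balanced : ∀ n {a b : Fin n} → a ≢ b → (g : Bool → Bool → ℕ) → ∑𝔹² g ≡ 2 →
                2 * ∑ₛ n (λ S → g (S a) (S b)) ≡ 2 ^ n
  ∑ₛ-balanced n {a} {b} a≢b g ∑g≡2 = *-cancelˡ-≡ _ _ 2 (begin
    2 * (2 * X)   ≡⟨ sym (*-assoc 2 2 X) ⟩
    4 * X         ≡⟨ ∑ₛ-coordinates n a≢b g ⟩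
    2 ^ n * ∑𝔹² g ≡⟨ cong (2 ^ n *_) ∑g≡2 ⟩
    2 ^ n * 2     ≡⟨ *-comm (2 ^ n) 2 ⟩
    2 * 2 ^ n     ∎)
    where
    open ≡-Reasoning
    X = ∑ₛ n (λ S → g (S a) (S b))

  ∑ₛ-xor : ∀ n {a b : Fin n} → a ≢ b → 2 * ∑ₛ n (λ S → indicator (S a xor S b)) ≡ 2 ^ n
  ∑ₛ-xor n a≢b = ∑ₛ-balanced n a≢b (λ x y → indicator (x xor y)) refl

  ∑ₛ-agree : ∀ n {a b : Fin n} → a ≢ b → 2 * ∑ₛ n (λ S → indicator (not (S a xor S b))) ≡ 2 ^ n
  ∑ₛ-agree n a≢b = ∑ₛ-balanced n a≢b (λ x y → indicator (not (x xor y))) refl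

  ∑ₛ-xor-xor : ∀ n {v b c : Fin n} → v ≢ b → v ≢ c →
               4 * ∑ₛ n (λ S → indicator (S v xor S b) * indicator (S v xor S c))
               ≡ 2 ^ n * (1 + indicator (does (b ≟ᶠ c)))
  ∑ₛ-xor-xor n {v} {b} {c} v≢b v≢c with b ≟ᶠ c
  ... | yes refl = begin
    4 * ∑ₛ n (λ S → indicator (S v xor S b) * indicator (S v xor S b))
      ≡⟨ cong (4 *_) (sumOver-cong (allSubsets n) λ S → indicator-idem (S v xor S b)) ⟩
    4 * ∑ₛ n (λ S → indicator (S v xor S b))
      ≡⟨ *-assoc 2 2 (∑ₛ n (λ S → indicator (S v xor S b))) ⟩
    2 * (2 * ∑ₛ n (λ S → indicator (S v xor S b)))
      ≡⟨ cong (2 *_) (∑ₛ-xor n v≢b) ⟩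
    2 * 2 ^ n
      ≡⟨ *-comm 2 (2 ^ n) ⟩
    2 ^ n * 2 ∎
    where open ≡-Reasoning
  ... | no b≢c = trans (+-cancelʳ-≡ (2 * 2 ^ n) (4 * E) (2 ^ n) (begin
    4 * E + 2 * 2 ^ n                      ≡⟨ double-sum E (2 ^ n) ⟩
    2 * (2 * E + 2 ^ n)                    ≡⟨ cong (2 *_) sum-of-identity ⟩
    2 * (A + B + C)                        ≡⟨ distribute A B C ⟩
    2 * A + 2 * B + 2 * C
      ≡⟨ cong₂ _+_ (cong₂ _+_ (∑ₛ-agree n b≢c) (∑ₛ-xor n v≢b)) (∑ₛ-xor n v≢c) ⟩
    2 ^ n + 2 ^ n + 2 ^ n                  ≡⟨ triple (2 ^ n) ⟩
    2 ^ n + 2 * 2 ^ n                      ∎))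
    (sym (*-identityʳ (2 ^ n)))
    where
    open ≡-Reasoning
    E = ∑ₛ n (λ S → indicator (S v xor S b) * indicator (S v xor S c))
    A = ∑ₛ n (λ S → indicator (not (S b xor S c)))
    B = ∑ₛ n (λ S → indicator (S v xor S b))
    C = ∑ₛ n (λ S → indicator (S v xor S c))
    sum-of-identity : 2 * E + 2 ^ n ≡ A + B + C
    sum-of-identity = begin
      2 * E + 2 ^ n
        ≡⟨ cong₂ _+_ (sym (sumOver-*ˡ (allSubsets n) 2 _)) (sym (trans (∑ₛ-const n 1) (*-identityʳ (2 ^ n)))) ⟩
      ∑ₛ n (λ S → 2 * (indicator (S v xor S b) * indicator (S v xor S c))) + ∑ₛ n (λ _ → 1)
        ≡⟨ sym (sumOver-distrib-+ (allSubsets n) _ _) ⟩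
      ∑ₛ n (λ S → 2 * (indicator (S v xor S b) * indicator (S v xor S c)) + 1)
        ≡⟨ sumOver-cong (allSubsets n) (λ S → xor-xor-identity (S v) (S b) (S c)) ⟩
      ∑ₛ n (λ S → indicator (not (S b xor S c)) + indicator (S v xor S b) + indicator (S v xor S c))
        ≡⟨ sumOver-distrib-+ (allSubsets n) _ _ ⟩
      ∑ₛ n (λ S → indicator (not (S b xor S c)) + indicator (S v xor S b)) + C
        ≡⟨ cong (_+ C) (sumOver-distrib-+ (allSubsets n) _ _) ⟩
      A + B + C ∎
    double-sum : ∀ e p → 4 * e + 2 * p ≡ 2 * (2 * e + p)
    double-sum = solve-∀
    distribute : ∀ a b c → 2 * (a + b + c) ≡ 2 * a + 2 * b + 2 * c
    distribute = solve-∀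
    triple : ∀ p → p + p + p ≡ p + 2 * p
    triple = solve-∀

  -- Degrees and cuts

  degree : ∀ {n} → Graph n → Fin n → ℕ
  degree {n} G v = ∑[ b < n ] indicator (adj G v b)

  degreeSum : ∀ {n} → Graph n → ℕ
  degreeSum {n} G = ∑[ v < n ] degree G v

  crossing : ∀ {n} → Graph n → Subset n → Fin n → Fin n → ℕ
  crossing G S a b = indicator (S a ∧ not (S b) ∧ adj G a b)

  crossingDegree : ∀ {n} → Graph n → Subset n → Fin n → ℕ
  crossingDegree {n} G S v = ∑[ b < n ] (indicator (adj G v b) * indicator (S v xor S b))

  cutWithout : ∀ {m} → Graph (suc m) → Fin (suc m) → Subset (suc m) → ℕ
  cutWithout G v S = cutSize (deleteVertex G v) (removeFromSubset S v)

  cutSize-∑ : ∀ {n} (G : Graph n) S → cutSize G S ≡ ∑[ a < n ] ∑[ b < n ] crossing G S a b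
  cutSize-∑ {n} G S =
    trans (∑-allFin (λ a → listSum (map (crossing G S a) (allFin n)))) (sum-cong-≗ λ a → ∑-allFin (crossing G S a))

  crossing-diag : ∀ {n} (G : Graph n) S a → crossing G S a a ≡ 0
  crossing-diag G S a with S a
  ... | true = refl
  ... | false = refl

  crossing-pair : ∀ {n} (G : Graph n) S a b →
                  crossing G S a b + crossing G S b a ≡ indicator (adj G a b) * indicator (S a xor S b)
  crossing-pair G S a b rewrite Graph.sym G b a with S a | S b | adj G a b
  ... | true  | true  | true  = refl
  ... | true  | true  | false = refl
  ... | false | false | true  = refl
  ... | false | false | false = refl
  ... | true  | false | true  = refl
  ... | true  | false | false = refl
  ... | false | true  | true  = refl
  ... | false | true  | false = refl

  crossingDegree-∑ : ∀ {n} (G : Graph n) S v →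
                     crossingDegree G S v ≡ ∑[ b < n ] crossing G S v b + ∑[ b < n ] crossing G S b v
  crossingDegree-∑ G S v =
    trans (sum-cong-≗ λ b → sym (crossing-pair G S v b)) (∑-distrib-+ (crossing G S v) (λ b → crossing G S b v))

  crossingDegree≤degree : ∀ {n} (G : Graph n) S v → crossingDegree G S v ≤ degree G v
  crossingDegree≤degree G S v = ∑-mono-≤ λ b → indicator-*-≤ (adj G v b) _

  2*cutSize≡∑crossingDegree : ∀ {n} (G : Graph n) S → 2 * cutSize G S ≡ ∑[ a < n ] crossingDegree G S a
  2*cutSize≡∑crossingDegree {n} G S = begin
    2 * cutSize G S ≡⟨ cong (2 *_) (cutSize-∑ G S) ⟩
    2 * C           ≡⟨ cong (C +_) (+-identityʳ C) ⟩
    C + C           ≡⟨ cong (C +_) (∑-comm (crossing G S)) ⟩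
    C + ∑[ a < n ] ∑[ b < n ] crossing G S b a
      ≡⟨ sym (∑-distrib-+ (λ a → ∑[ b < n ] crossing G S a b) (λ a → ∑[ b < n ] crossing G S b a)) ⟩
    ∑[ a < n ] (∑[ b < n ] crossing G S a b + ∑[ b < n ] crossing G S b a)
      ≡⟨ sum-cong-≗ (λ a → sym (crossingDegree-∑ G S a)) ⟩
    ∑[ a < n ] crossingDegree G S a ∎
    where
    open ≡-Reasoning
    C = ∑[ a < n ] ∑[ b < n ] crossing G S a b

  2*cutSize≤degreeSum : ∀ {n} (G : Graph n) S → 2 * cutSize G S ≤ degreeSum G
  2*cutSize≤degreeSum G S =
    ≤-trans (≤-reflexive (2*cutSize≡∑crossingDegree G S)) (∑-mono-≤ (crossingDegree≤degree G S))

  cutSize-deleteVertex : ∀ {m} (G : Graph (suc m)) S v → cutSize G S ≡ cutWithout G v S + crossingDegree G S v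
  cutSize-deleteVertex {m} G S v = begin
    cutSize G S
      ≡⟨ cutSize-∑ G S ⟩
    ∑[ a < suc m ] ∑[ b < suc m ] K a b
      ≡⟨ sum-remove {i = v} (λ a → ∑[ b < suc m ] K a b) ⟩
    out + ∑[ i < m ] ∑[ b < suc m ] K (punchIn v i) b
      ≡⟨ cong (out +_) (sum-cong-≗ λ i → sum-remove {i = v} (K (punchIn v i))) ⟩
    out + ∑[ i < m ] (K (punchIn v i) v + ∑[ j < m ] K (punchIn v i) (punchIn v j))
      ≡⟨ cong (out +_) (∑-distrib-+ (λ i → K (punchIn v i) v) (λ i → ∑[ j < m ] K (punchIn v i) (punchIn v j))) ⟩
    out + (∑[ i < m ] K (punchIn v i) v + ∑[ i < m ] ∑[ j < m ] K (punchIn v i) (punchIn v j))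
      ≡⟨ cong₂ (λ x y → out + (x + y)) into (sym (cutSize-∑ (deleteVertex G v) (removeFromSubset S v))) ⟩
    out + (∑[ b < suc m ] K b v + Y)
      ≡⟨ rearrange out _ Y ⟩
    Y + (out + ∑[ b < suc m ] K b v)
      ≡⟨ cong (Y +_) (sym (crossingDegree-∑ G S v)) ⟩
    Y + crossingDegree G S v ∎
    where
    open ≡-Reasoning
    K = crossing G S
    out = ∑[ b < suc m ] K v b
    Y = cutWithout G v S
    into : ∑[ i < m ] K (punchIn v i) v ≡ ∑[ b < suc m ] K b v
    into = sym (trans (sum-remove {i = v} (λ b → K b v))
                      (cong (_+ ∑[ i < m ] K (punchIn v i) v) (crossing-diag G S v)))
    rearrange : ∀ a b c → a + (b + c) ≡ c + (a + b)
    rearrange = solve-∀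

  crossingDegree≤cutSize : ∀ {n} (G : Graph n) S v → crossingDegree G S v ≤ cutSize G S
  crossingDegree≤cutSize {suc m} G S v =
    ≤-trans (m≤n+m _ (cutWithout G v S)) (≤-reflexive (sym (cutSize-deleteVertex G S v)))

  crossingDegree≤1+cutWithout : ∀ {m} (G : Graph (suc m)) S {u v} → u ≢ v →
                                crossingDegree G S u ≤ 1 + cutWithout G v S
  crossingDegree≤1+cutWithout G S {u} {v} u≢v =
    subst (λ x → crossingDegree G S x ≤ 1 + cutWithout G v S) (punchIn-punchOut v≢u) (begin
      crossingDegree G S (punchIn v w)
        ≡⟨ sum-remove {i = v} (λ b → indicator (adj G (punchIn v w) b) * indicator (S (punchIn v w) xor S b)) ⟩
      indicator (adj G (punchIn v w) v) * indicator (S (punchIn v w) xor S v)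
        + crossingDegree (deleteVertex G v) (removeFromSubset S v) w
        ≤⟨ +-mono-≤ (≤-trans (indicator-*-≤ (adj G (punchIn v w) v) _) (indicator≤1 (adj G (punchIn v w) v)))
                    (crossingDegree≤cutSize (deleteVertex G v) (removeFromSubset S v) w) ⟩
      1 + cutWithout G v S ∎)
    where
    open ≤-Reasoning
    v≢u = u≢v ∘ sym
    w = punchOut v≢u

  degree-punchIn : ∀ {m} (G : Graph (suc m)) u → degree G u ≡ ∑[ i < m ] indicator (adj G u (punchIn u i))
  degree-punchIn {m} G u =
    trans (sum-remove {i = u} (λ b → indicator (adj G u b)))
          (cong (λ b → indicator b + ∑[ i < m ] indicator (adj G u (punchIn u i))) (Graph.irrefl G u))

  degreeSum-deleteVertex : ∀ {m} (G : Graph (suc m)) u →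
                           degreeSum G ≡ 2 * degree G u + degreeSum (deleteVertex G u)
  degreeSum-deleteVertex {m} G u = begin
    degreeSum G
      ≡⟨ sum-remove {i = u} (degree G) ⟩
    degree G u + ∑[ i < m ] degree G (punchIn u i)
      ≡⟨ cong (degree G u +_) (sum-cong-≗ λ i → sum-remove {i = u} (λ b → indicator (adj G (punchIn u i) b))) ⟩
    degree G u + ∑[ i < m ] (indicator (adj G (punchIn u i) u) + degree (deleteVertex G u) i)
      ≡⟨ cong (degree G u +_) (∑-distrib-+ (λ i → indicator (adj G (punchIn u i) u)) (degree (deleteVertex G u))) ⟩
    degree G u + (∑[ i < m ] indicator (adj G (punchIn u i) u) + D)
      ≡⟨ cong (λ x → degree G u + (x + D)) (sum-cong-≗ λ i → cong indicator (Graph.sym G (punchIn u i) u)) ⟩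
    degree G u + (∑[ i < m ] indicator (adj G u (punchIn u i)) + D)
      ≡⟨ cong (λ x → degree G u + (x + D)) (sym (degree-punchIn G u)) ⟩
    degree G u + (degree G u + D)
      ≡⟨ double (degree G u) D ⟩
    2 * degree G u + D ∎
    where
    open ≡-Reasoning
    D = degreeSum (deleteVertex G u)
    double : ∀ a d → a + (a + d) ≡ 2 * a + d
    double = solve-∀

  Reach-firstEdge : ∀ {n} {G : Graph n} {x y} → Reach G x y → x ≢ y → ∃[ w ] adj G x w ≡ true
  Reach-firstEdge here x≢x = contradiction refl x≢x
  Reach-firstEdge (step {w = w} x~w _) _ = w , x~w

  connected⇒m≤degree+degreeSum : ∀ {m} (G : Graph (suc m)) → Connected G → ∀ u →
                                 m ≤ degree G u + degreeSum (deleteVertex G u)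
  connected⇒m≤degree+degreeSum {m} G connected u = begin
    m                      ≡⟨ sym (trans (∑-const m 1) (*-identityʳ m)) ⟩
    ∑[ i < m ] 1           ≤⟨ ∑-mono-≤ covered ⟩
    ∑[ i < m ] (indicator (adj G u (punchIn u i)) + degree (deleteVertex G u) i)
      ≡⟨ ∑-distrib-+ (λ i → indicator (adj G u (punchIn u i))) (degree (deleteVertex G u)) ⟩
    ∑[ i < m ] indicator (adj G u (punchIn u i)) + degreeSum (deleteVertex G u)
      ≡⟨ cong (_+ degreeSum (deleteVertex G u)) (sym (degree-punchIn G u)) ⟩
    degree G u + degreeSum (deleteVertex G u) ∎
    where
    open ≤-Reasoning
    edge : ∀ {b} → b ≡ true → 1 ≤ indicator b
    edge refl = ≤-refl
    covered : ∀ i → 1 ≤ indicator (adj G u (punchIn u i)) + degree (deleteVertex G u) i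
    covered i with Reach-firstEdge (connected (punchIn u i) u) (punchInᵢ≢i u i)
    ... | w , i~w with u ≟ᶠ w
    ...   | yes refl = ≤-trans (edge (trans (Graph.sym G u (punchIn u i)) i~w)) (m≤m+n _ _)
    ...   | no u≢w = ≤-trans (edge (subst (λ x → adj G (punchIn u i) x ≡ true) (sym (punchIn-punchOut u≢w)) i~w))
                     (≤-trans (summand≤∑ (λ j → indicator (adj G (punchIn u i) (punchIn u j))) (punchOut u≢w))
                              (m≤n+m _ _))

  maxDegreeVertex : ∀ {m} → Graph (suc m) → Fin (suc m)
  maxDegreeVertex {m} G = argmax (degree G) zero (allFin (suc m))

  degree≤maxDegree : ∀ {m} (G : Graph (suc m)) v → degree G v ≤ degree G (maxDegreeVertex G)
  degree≤maxDegree {m} G v = All.lookup (f[xs]≤f[argmax] {f = degree G} zero (allFin (suc m))) (∈-allFin v)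

  -- Moments of the crossing degree

  loop-or-distinct : ∀ {n} (G : Graph n) v b → indicator (adj G v b) ≡ 0 ⊎ v ≢ b
  loop-or-distinct G v b with v ≟ᶠ b
  ... | yes refl = inj₁ (cong indicator (Graph.irrefl G v))
  ... | no v≢b = inj₂ v≢b

  ∑ₛ-crossingDegree : ∀ {n} (G : Graph n) v → 2 * ∑ₛ n (λ S → crossingDegree G S v) ≡ 2 ^ n * degree G v
  ∑ₛ-crossingDegree {n} G v = begin
    2 * ∑ₛ n (λ S → crossingDegree G S v)
      ≡⟨ cong (2 *_) (sumOver-∑ (allSubsets n) (λ S b → a b * x S b)) ⟩
    2 * ∑[ b < n ] ∑ₛ n (λ S → a b * x S b)
      ≡⟨ sym (∑-*ˡ 2 (λ b → ∑ₛ n (λ S → a b * x S b))) ⟩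
    ∑[ b < n ] (2 * ∑ₛ n (λ S → a b * x S b))
      ≡⟨ sum-cong-≗ term ⟩
    ∑[ b < n ] (a b * 2 ^ n)
      ≡⟨ sum-cong-≗ (λ b → *-comm (a b) (2 ^ n)) ⟩
    ∑[ b < n ] (2 ^ n * a b)
      ≡⟨ ∑-*ˡ (2 ^ n) a ⟩
    2 ^ n * degree G v ∎
    where
    open ≡-Reasoning
    a : Fin n → ℕ
    a b = indicator (adj G v b)
    x : Subset n → Fin n → ℕ
    x S b = indicator (S v xor S b)
    term : ∀ b → 2 * ∑ₛ n (λ S → a b * x S b) ≡ a b * 2 ^ n
    term b = trans (cong (2 *_) (sumOver-*ˡ (allSubsets n) (a b) (λ S → x S b)))
                   (scale-or-vanish 2 (a b) _ (2 ^ n) (map₂ (∑ₛ-xor n) (loop-or-distinct G v b)))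

  ∑ₛ-crossingDegree² : ∀ {n} (G : Graph n) v →
                       4 * ∑ₛ n (λ S → crossingDegree G S v ²) ≡ 2 ^ n * (degree G v ² + degree G v)
  ∑ₛ-crossingDegree² {n} G v = begin
    4 * ∑ₛ n (λ S → crossingDegree G S v ²)
      ≡⟨ cong (4 *_) (sumOver-cong (allSubsets n) λ S → ∑*∑ (ax S) (ax S)) ⟩
    4 * ∑ₛ n (λ S → ∑[ b < n ] ∑[ c < n ] (ax S b * ax S c))
      ≡⟨ cong (4 *_) (sumOver-∑ (allSubsets n) (λ S b → ∑[ c < n ] (ax S b * ax S c))) ⟩
    4 * ∑[ b < n ] ∑ₛ n (λ S → ∑[ c < n ] (ax S b * ax S c))
      ≡⟨ cong (4 *_) (sum-cong-≗ λ b → sumOver-∑ (allSubsets n) (λ S c → ax S b * ax S c)) ⟩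
    4 * ∑[ b < n ] ∑[ c < n ] ∑ₛ n (λ S → ax S b * ax S c)
      ≡⟨ sym (∑-*ˡ 4 (λ b → ∑[ c < n ] ∑ₛ n (λ S → ax S b * ax S c))) ⟩
    ∑[ b < n ] (4 * ∑[ c < n ] ∑ₛ n (λ S → ax S b * ax S c))
      ≡⟨ sum-cong-≗ (λ b → sym (∑-*ˡ 4 (λ c → ∑ₛ n (λ S → ax S b * ax S c)))) ⟩
    ∑[ b < n ] ∑[ c < n ] (4 * ∑ₛ n (λ S → ax S b * ax S c))
      ≡⟨ sum-cong-≗ (λ b → sum-cong-≗ (term b)) ⟩
    ∑[ b < n ] ∑[ c < n ] (2 ^ n * (a b * a c * (1 + δ b c)))
      ≡⟨ sum-cong-≗ (λ b → ∑-*ˡ (2 ^ n) (λ c → a b * a c * (1 + δ b c))) ⟩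
    ∑[ b < n ] (2 ^ n * ∑[ c < n ] (a b * a c * (1 + δ b c)))
      ≡⟨ ∑-*ˡ (2 ^ n) (λ b → ∑[ c < n ] (a b * a c * (1 + δ b c))) ⟩
    2 ^ n * ∑[ b < n ] ∑[ c < n ] (a b * a c * (1 + δ b c))
      ≡⟨ cong (2 ^ n *_) pair-sum ⟩
    2 ^ n * (degree G v ² + degree G v) ∎
    where
    open ≡-Reasoning
    a : Fin n → ℕ
    a b = indicator (adj G v b)
    x : Subset n → Fin n → ℕ
    x S b = indicator (S v xor S b)
    ax : Subset n → Fin n → ℕ
    ax S b = a b * x S b
    δ : Fin n → Fin n → ℕ
    δ b c = indicator (does (b ≟ᶠ c))
    vanish-or-distinct : ∀ b c → a b * a c ≡ 0 ⊎ (v ≢ b × v ≢ c)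
    vanish-or-distinct b c with loop-or-distinct G v b | loop-or-distinct G v c
    ... | inj₁ a≡0 | _         = inj₁ (cong (_* a c) a≡0)
    ... | inj₂ _   | inj₁ a≡0  = inj₁ (trans (cong (a b *_) a≡0) (*-zeroʳ (a b)))
    ... | inj₂ v≢b | inj₂ v≢c  = inj₂ (v≢b , v≢c)
    term : ∀ b c → 4 * ∑ₛ n (λ S → ax S b * ax S c) ≡ 2 ^ n * (a b * a c * (1 + δ b c))
    term b c = begin
      4 * ∑ₛ n (λ S → ax S b * ax S c)
        ≡⟨ cong (4 *_) (sumOver-cong (allSubsets n) λ S → [m*n]*[o*p]≡[m*o]*[n*p] (a b) (x S b) (a c) (x S c)) ⟩
      4 * ∑ₛ n (λ S → a b * a c * (x S b * x S c))
        ≡⟨ cong (4 *_) (sumOver-*ˡ (allSubsets n) (a b * a c) (λ S → x S b * x S c)) ⟩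
      4 * (a b * a c * ∑ₛ n (λ S → x S b * x S c))
        ≡⟨ scale-or-vanish 4 (a b * a c) _ (2 ^ n * (1 + δ b c))
             (map₂ (λ (v≢b , v≢c) → ∑ₛ-xor-xor n v≢b v≢c) (vanish-or-distinct b c)) ⟩
      a b * a c * (2 ^ n * (1 + δ b c))
        ≡⟨ *-comm-middle (a b * a c) (2 ^ n) (1 + δ b c) ⟩
      2 ^ n * (a b * a c * (1 + δ b c)) ∎
      where
      *-comm-middle : ∀ x y z → x * (y * z) ≡ y * (x * z)
      *-comm-middle = solve-∀
    pair-sum : ∑[ b < n ] ∑[ c < n ] (a b * a c * (1 + δ b c)) ≡ degree G v ² + degree G v
    pair-sum = begin
      ∑[ b < n ] ∑[ c < n ] (a b * a c * (1 + δ b c))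
        ≡⟨ sum-cong-≗ (λ b → sum-cong-≗ λ c → *-distribˡ-+ (a b * a c) 1 (δ b c)) ⟩
      ∑[ b < n ] ∑[ c < n ] (a b * a c * 1 + a b * a c * δ b c)
        ≡⟨ sum-cong-≗ (λ b → ∑-distrib-+ (λ c → a b * a c * 1) (λ c → a b * a c * δ b c)) ⟩
      ∑[ b < n ] (∑[ c < n ] (a b * a c * 1) + ∑[ c < n ] (a b * a c * δ b c))
        ≡⟨ ∑-distrib-+ (λ b → ∑[ c < n ] (a b * a c * 1)) (λ b → ∑[ c < n ] (a b * a c * δ b c)) ⟩
      ∑[ b < n ] ∑[ c < n ] (a b * a c * 1) + ∑[ b < n ] ∑[ c < n ] (a b * a c * δ b c)
        ≡⟨ cong₂ _+_ (sum-cong-≗ λ b → sum-cong-≗ λ c → *-identityʳ (a b * a c))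
                     (sum-cong-≗ λ b → ∑-indicator-≡ (λ c → a b * a c) b) ⟩
      ∑[ b < n ] ∑[ c < n ] (a b * a c) + ∑[ b < n ] (a b * a b)
        ≡⟨ cong₂ _+_ (sym (∑*∑ a a)) (sum-cong-≗ λ b → indicator-idem (adj G v b)) ⟩
      degree G v ² + degree G v ∎

  deviation² : ∀ {n} → Graph n → Subset n → Fin n → ℕ
  deviation² G S v = ∣ degree G v - 2 * crossingDegree G S v ∣ ²

  -- Var(2 c_v(S)) = deg v, as c_v(S) is Bin(deg v, 1/2).
  ∑ₛ-deviation² : ∀ {n} (G : Graph n) v → ∑ₛ n (λ S → deviation² G S v) ≡ 2 ^ n * degree G v
  ∑ₛ-deviation² {n} G v = +-cancelʳ-≡ X _ _ (begin
    Dev + X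
      ≡⟨ cong (λ y → Dev + 2 * d * y) (sym (∑ₛ-crossingDegree G v)) ⟩
    Dev + 2 * d * (2 * ∑ₛ n c)
      ≡⟨ cong (λ y → Dev + 2 * d * y) (sym (sumOver-*ˡ (allSubsets n) 2 c)) ⟩
    Dev + 2 * d * ∑ₛ n (λ S → 2 * c S)
      ≡⟨ cong (Dev +_) (sym (sumOver-*ˡ (allSubsets n) (2 * d) (λ S → 2 * c S))) ⟩
    Dev + ∑ₛ n (λ S → 2 * d * (2 * c S))
      ≡⟨ sym (sumOver-distrib-+ (allSubsets n) (λ S → ∣ d - 2 * c S ∣ ²) (λ S → 2 * d * (2 * c S))) ⟩
    ∑ₛ n (λ S → ∣ d - 2 * c S ∣ ² + 2 * d * (2 * c S))
      ≡⟨ sumOver-cong (allSubsets n) (λ S → ∣m-n∣²+2mn≡m²+n² d (2 * c S)) ⟩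
    ∑ₛ n (λ S → d ² + (2 * c S) ²)
      ≡⟨ sumOver-distrib-+ (allSubsets n) (λ _ → d ²) (λ S → (2 * c S) ²) ⟩
    ∑ₛ n (λ _ → d ²) + ∑ₛ n (λ S → (2 * c S) ²)
      ≡⟨ cong₂ _+_ (∑ₛ-const n (d ²)) (sumOver-cong (allSubsets n) λ S → [2x]²≡4x² (c S)) ⟩
    2 ^ n * d ² + ∑ₛ n (λ S → 4 * c S ²)
      ≡⟨ cong (2 ^ n * d ² +_) (sumOver-*ˡ (allSubsets n) 4 (λ S → c S ²)) ⟩
    2 ^ n * d ² + 4 * ∑ₛ n (λ S → c S ²)
      ≡⟨ cong (2 ^ n * d ² +_) (∑ₛ-crossingDegree² G v) ⟩
    2 ^ n * d ² + 2 ^ n * (d ² + d)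
      ≡⟨ collect (2 ^ n) d ⟩
    2 ^ n * d + X ∎)
    where
    open ≡-Reasoning
    d = degree G v
    c : Subset n → ℕ
    c S = crossingDegree G S v
    Dev = ∑ₛ n (λ S → ∣ d - 2 * c S ∣ ²)
    X = 2 * d * (2 ^ n * d)
    [2x]²≡4x² : ∀ x → (2 * x) * (2 * x) ≡ 4 * (x * x)
    [2x]²≡4x² = solve-∀
    collect : ∀ p d → p * (d * d) + p * (d * d + d) ≡ p * d + 2 * d * (p * d)
    collect = solve-∀

  ∑ₛ-cutSize-∘ : ∀ {m n} (H : Graph m) (p : Fin m → Fin n) → (∀ {i j} → p i ≡ p j → i ≡ j) →
                 4 * ∑ₛ n (λ S → cutSize H (S ∘ p)) ≡ 2 ^ n * degreeSum H
  ∑ₛ-cutSize-∘ {m} {n} H p p-injective = begin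
    4 * ∑ₛ n (λ S → cutSize H (S ∘ p))
      ≡⟨ cong (4 *_) (sumOver-cong (allSubsets n) λ S → cutSize-∑ H (S ∘ p)) ⟩
    4 * ∑ₛ n (λ S → ∑[ i < m ] ∑[ j < m ] K S i j)
      ≡⟨ cong (4 *_) (sumOver-∑ (allSubsets n) (λ S i → ∑[ j < m ] K S i j)) ⟩
    4 * ∑[ i < m ] ∑ₛ n (λ S → ∑[ j < m ] K S i j)
      ≡⟨ cong (4 *_) (sum-cong-≗ λ i → sumOver-∑ (allSubsets n) (λ S j → K S i j)) ⟩
    4 * ∑[ i < m ] ∑[ j < m ] ∑ₛ n (λ S → K S i j)
      ≡⟨ sym (∑-*ˡ 4 (λ i → ∑[ j < m ] ∑ₛ n (λ S → K S i j))) ⟩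
    ∑[ i < m ] (4 * ∑[ j < m ] ∑ₛ n (λ S → K S i j))
      ≡⟨ sum-cong-≗ (λ i → sym (∑-*ˡ 4 (λ j → ∑ₛ n (λ S → K S i j)))) ⟩
    ∑[ i < m ] ∑[ j < m ] (4 * ∑ₛ n (λ S → K S i j))
      ≡⟨ sum-cong-≗ (λ i → sum-cong-≗ (term i)) ⟩
    ∑[ i < m ] ∑[ j < m ] (2 ^ n * indicator (adj H i j))
      ≡⟨ sum-cong-≗ (λ i → ∑-*ˡ (2 ^ n) (λ j → indicator (adj H i j))) ⟩
    ∑[ i < m ] (2 ^ n * degree H i)
      ≡⟨ ∑-*ˡ (2 ^ n) (degree H) ⟩
    2 ^ n * degreeSum H ∎
    where
    open ≡-Reasoning
    K : Subset n → Fin m → Fin m → ℕ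
    K S = crossing H (S ∘ p)
    term : ∀ i j → 4 * ∑ₛ n (λ S → K S i j) ≡ 2 ^ n * indicator (adj H i j)
    term i j with i ≟ᶠ j
    ... | yes refl = begin
      4 * ∑ₛ n (λ S → K S i i)   ≡⟨ cong (4 *_) (sumOver-cong (allSubsets n) λ S → crossing-diag H (S ∘ p) i) ⟩
      4 * ∑ₛ n (λ _ → 0)         ≡⟨ cong (4 *_) (trans (∑ₛ-const n 0) (*-zeroʳ (2 ^ n))) ⟩
      0                           ≡⟨ sym (*-zeroʳ (2 ^ n)) ⟩
      2 ^ n * 0                   ≡⟨ cong (λ b → 2 ^ n * indicator b) (sym (Graph.irrefl H i)) ⟩
      2 ^ n * indicator (adj H i i) ∎
    ... | no i≢j = trans (∑ₛ-coordinates n (i≢j ∘ p-injective) (λ x y → indicator (x ∧ not y ∧ adj H i j)))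
                         (cong (2 ^ n *_) (trans (+-identityʳ _) (+-identityʳ _)))

  -- The fault-tolerant cut

  foldr-attained : ∀ {A : Set} {_•_ : ℕ → ℕ → ℕ} → Selective _≡_ _•_ → ∀ e (f : A → ℕ) xs →
                   foldr _•_ e (map f xs) ≡ e ⊎ ∃[ x ] foldr _•_ e (map f xs) ≡ f x
  foldr-attained •-sel e f xs with foldr-selective •-sel e (map f xs)
  ... | inj₁ ≡e = inj₁ ≡e
  ... | inj₂ ∈fxs with ∈-map⁻ f ∈fxs
  ...   | x , _ , ≡fx = inj₂ (x , ≡fx)

  foldr-⊓-≤ : ∀ e {x} xs → x ∈ xs → foldr _⊓_ e xs ≤ x
  foldr-⊓-≤ e (y ∷ ys) (here refl) = m⊓n≤m y _
  foldr-⊓-≤ e (y ∷ ys) (there x∈ys) = ≤-trans (m⊓n≤n y _) (foldr-⊓-≤ e ys x∈ys)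

  φ-attained : ∀ {m} (G : Graph (suc m)) S → ∃[ v ] φ G S ≡ cutWithout G v S
  φ-attained {m} G S with foldr-attained ⊓-sel (cutWithout G zero S) (λ v → cutWithout G v S) (allFin (suc m))
  ... | inj₁ ≡first = zero , ≡first
  ... | inj₂ attained = attained

  φ≤cutWithout : ∀ {m} (G : Graph (suc m)) S u → φ G S ≤ cutWithout G u S
  φ≤cutWithout {m} G S u = foldr-⊓-≤ _ _ (∈-map⁺ (λ v → cutWithout G v S) (∈-allFin u))

  2*maxφ≤degreeSum-deleteVertex : ∀ {m} (G : Graph (suc m)) u → 2 * maxφ G ≤ degreeSum (deleteVertex G u)
  2*maxφ≤degreeSum-deleteVertex {m} G u with foldr-attained ⊔-sel 0 (φ G) (allSubsets (suc m))
  ... | inj₁ ≡0 = ≤-trans (≤-reflexive (cong (2 *_) ≡0)) z≤n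
  ... | inj₂ (S , ≡φ) = begin
    2 * maxφ G              ≡⟨ cong (2 *_) ≡φ ⟩
    2 * φ G S               ≤⟨ *-monoʳ-≤ 2 (φ≤cutWithout G S u) ⟩
    2 * cutWithout G u S    ≤⟨ 2*cutSize≤degreeSum (deleteVertex G u) (removeFromSubset S u) ⟩
    degreeSum (deleteVertex G u) ∎
    where open ≤-Reasoning

  -- The counting bound

  module _ {m : ℕ} (G : Graph (suc m)) (u : Fin (suc m)) where

    private
      n = suc m
      Δ = degree G u
      D = degreeSum (deleteVertex G u)
      T = ∑ₛ n (φ G)

    ∑ₛ-cutWithout : 4 * ∑ₛ n (cutWithout G u) ≡ 2 ^ n * D
    ∑ₛ-cutWithout = ∑ₛ-cutSize-∘ (deleteVertex G u) (punchIn u) (punchIn-injective u _ _)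

    fewCrossing : Subset n → ℕ
    fewCrossing S = indicator (does (crossingDegree G S u ≤? D))

    -- When c_u(S) > D, deleting any v ≠ u still cuts at least c_u(S) - 1 ≥ D ≥ 2 C_{S-u,G-u} edges.
    2*cutWithout≤2*φ+D*fewCrossing : ∀ S → 2 * cutWithout G u S ≤ 2 * φ G S + D * fewCrossing S
    2*cutWithout≤2*φ+D*fewCrossing S = bound (crossingDegree G S u ≤? D)
      where
      2*cutWithout≤D : 2 * cutWithout G u S ≤ D
      2*cutWithout≤D = 2*cutSize≤degreeSum (deleteVertex G u) (removeFromSubset S u)
      bound : (c≤?D : Dec (crossingDegree G S u ≤ D)) →
              2 * cutWithout G u S ≤ 2 * φ G S + D * indicator (does c≤?D)
      bound (yes _) = ≤-trans 2*cutWithout≤D (≤-trans (≤-reflexive (sym (*-identityʳ D))) (m≤n+m (D * 1) _))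
      bound (no c≰D) = ≤-trans 2*cutWithout≤2*φ (m≤m+n (2 * φ G S) (D * 0))
        where
        2*cutWithout≤2*φ : 2 * cutWithout G u S ≤ 2 * φ G S
        2*cutWithout≤2*φ with φ-attained G S
        ... | v , φ≡ rewrite φ≡ with u ≟ᶠ v
        ...   | yes refl = ≤-refl
        ...   | no u≢v = ≤-trans 2*cutWithout≤D (≤-trans D≤cutWithout (m≤m+n (cutWithout G v S) _))
          where
          D≤cutWithout : D ≤ cutWithout G v S
          D≤cutWithout = ≤-pred (≤-trans (≰⇒> c≰D) (crossingDegree≤1+cutWithout G S u≢v))

    2ⁿD≤4∑φ+2D∑fewCrossing : 2 ^ n * D ≤ 4 * T + 2 * D * ∑ₛ n fewCrossing
    2ⁿD≤4∑φ+2D∑fewCrossing = begin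
      2 ^ n * D                                  ≡⟨ sym ∑ₛ-cutWithout ⟩
      4 * ∑ₛ n (cutWithout G u)                  ≡⟨ *-assoc 2 2 (∑ₛ n (cutWithout G u)) ⟩
      2 * (2 * ∑ₛ n (cutWithout G u))
        ≡⟨ cong (2 *_) (sym (sumOver-*ˡ (allSubsets n) 2 (cutWithout G u))) ⟩
      2 * ∑ₛ n (λ S → 2 * cutWithout G u S)
        ≤⟨ *-monoʳ-≤ 2 (sumOver-mono-≤ (allSubsets n) 2*cutWithout≤2*φ+D*fewCrossing) ⟩
      2 * ∑ₛ n (λ S → 2 * φ G S + D * fewCrossing S)
        ≡⟨ cong (2 *_) (sumOver-distrib-+ (allSubsets n) (λ S → 2 * φ G S) (λ S → D * fewCrossing S)) ⟩
      2 * (∑ₛ n (λ S → 2 * φ G S) + ∑ₛ n (λ S → D * fewCrossing S))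
        ≡⟨ cong (2 *_) (cong₂ _+_ (sumOver-*ˡ (allSubsets n) 2 (φ G)) (sumOver-*ˡ (allSubsets n) D fewCrossing)) ⟩
      2 * (2 * T + D * ∑ₛ n fewCrossing)         ≡⟨ expand T D (∑ₛ n fewCrossing) ⟩
      4 * T + 2 * D * ∑ₛ n fewCrossing           ∎
      where
      open ≤-Reasoning
      expand : ∀ t d b → 2 * (2 * t + d * b) ≡ 4 * t + 2 * d * b
      expand = solve-∀

    ∑ₛ-fewCrossing*Δ²≤4*2ⁿΔ : 4 * D ≤ Δ → ∑ₛ n fewCrossing * Δ ² ≤ 4 * (2 ^ n * Δ)
    ∑ₛ-fewCrossing*Δ²≤4*2ⁿΔ 4D≤Δ = begin
      ∑ₛ n fewCrossing * Δ ²                   ≡⟨ *-comm (∑ₛ n fewCrossing) (Δ ²) ⟩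
      Δ ² * ∑ₛ n fewCrossing                   ≡⟨ sym (sumOver-*ˡ (allSubsets n) (Δ ²) fewCrossing) ⟩
      ∑ₛ n (λ S → Δ ² * fewCrossing S)         ≤⟨ sumOver-mono-≤ (allSubsets n) Chebyshev ⟩
      ∑ₛ n (λ S → 4 * deviation² G S u)        ≡⟨ sumOver-*ˡ (allSubsets n) 4 (λ S → deviation² G S u) ⟩
      4 * ∑ₛ n (λ S → deviation² G S u)        ≡⟨ cong (4 *_) (∑ₛ-deviation² G u) ⟩
      4 * (2 ^ n * Δ)                          ∎
      where
      open ≤-Reasoning
      Chebyshev : ∀ S → Δ ² * fewCrossing S ≤ 4 * deviation² G S u
      Chebyshev S = bound (crossingDegree G S u ≤? D)
        where
        bound : (c≤?D : Dec (crossingDegree G S u ≤ D)) → Δ ² * indicator (does c≤?D) ≤ 4 * deviation² G S u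
        bound (yes c≤D) = ≤-trans (≤-reflexive (*-identityʳ (Δ ²)))
                                  (Δ²≤4∣Δ-2c∣² Δ (crossingDegree G S u) (≤-trans (*-monoʳ-≤ 4 c≤D) 4D≤Δ))
        bound (no _) = ≤-trans (≤-reflexive (*-zeroʳ (Δ ²))) z≤n

    [2+j]∑fewCrossing≤2ⁿ : ∀ j → 4 * D ≤ Δ → 4 * (2 + j) ≤ Δ → (2 + j) * ∑ₛ n fewCrossing ≤ 2 ^ n
    [2+j]∑fewCrossing≤2ⁿ j 4D≤Δ 4k≤Δ = *-cancelˡ-≤ 4 (begin
      4 * (k * B) ≡⟨ rotate k B ⟩
      B * (4 * k) ≤⟨ *-monoʳ-≤ B 4k≤Δ ⟩
      B * Δ       ≤⟨ BΔ≤4P ⟩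
      4 * 2 ^ n   ∎)
      where
      open ≤-Reasoning
      k = 2 + j
      B = ∑ₛ n fewCrossing
      rotate : ∀ k b → 4 * (k * b) ≡ b * (4 * k)
      rotate = solve-∀
      BΔ≤4P : B * Δ ≤ 4 * 2 ^ n
      BΔ≤4P = *-cancelʳ-≤ (B * Δ) (4 * 2 ^ n) Δ {{>-nonZero (≤-trans (s≤s z≤n) 4k≤Δ)}}
                (subst₂ _≤_ (sym (*-assoc B Δ Δ)) (sym (*-assoc 4 (2 ^ n) Δ)) (∑ₛ-fewCrossing*Δ²≤4*2ⁿΔ 4D≤Δ))

    heavy-vertex-case : ∀ j → 4 * D ≤ Δ → 4 * (2 + j) ≤ Δ → j * (2 ^ n * D) ≤ 4 * (2 + j) * T
    heavy-vertex-case j 4D≤Δ 4k≤Δ = [2+j]x≤y+2x⇒jx≤y j (begin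
      k * (P * D)                 ≤⟨ *-monoʳ-≤ k 2ⁿD≤4∑φ+2D∑fewCrossing ⟩
      k * (4 * T + 2 * D * B)     ≡⟨ distribute k T D B ⟩
      4 * k * T + 2 * D * (k * B) ≤⟨ +-monoʳ-≤ (4 * k * T) (*-monoʳ-≤ (2 * D) ([2+j]∑fewCrossing≤2ⁿ j 4D≤Δ 4k≤Δ)) ⟩
      4 * k * T + 2 * D * P       ≡⟨ cong (4 * k * T +_) (regroup D P) ⟩
      4 * k * T + 2 * (P * D)     ∎)
      where
      open ≤-Reasoning
      k = 2 + j
      P = 2 ^ n
      B = ∑ₛ n fewCrossing
      distribute : ∀ k t d b → k * (4 * t + 2 * d * b) ≡ 4 * k * t + 2 * d * (k * b)
      distribute = solve-∀
      regroup : ∀ d p → 2 * d * p ≡ 2 * (p * d)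
      regroup = solve-∀

    module _ (Δ-maximum : ∀ v → degree G v ≤ Δ) (t : ℕ) where

      4t*cutWithout≤4t*φ+loss : ∀ S → 4 * t * cutWithout G u S
                                      ≤ 4 * t * φ G S + (2 * t ² + ∑[ v < n ] deviation² G S v + deviation² G S u)
      4t*cutWithout≤4t*φ+loss S with φ-attained G S
      ... | v , φ≡ rewrite φ≡ =
        ≤-trans (exchange-bound t {cutWithout G u S} {cutWithout G v S}
                                  {crossingDegree G S u} {crossingDegree G S v} cut-balance (Δ-maximum v))
                (+-monoʳ-≤ (4 * t * cutWithout G v S)
                           (+-monoˡ-≤ (deviation² G S u) (+-monoʳ-≤ (2 * t ²) (summand≤∑ (deviation² G S) v))))
        where
        cut-balance : cutWithout G u S + crossingDegree G S u ≡ cutWithout G v S + crossingDegree G S v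
        cut-balance = trans (sym (cutSize-deleteVertex G S u)) (cutSize-deleteVertex G S v)

      t*2ⁿD≤4t∑φ+2ⁿloss : t * (2 ^ n * D) ≤ 4 * t * T + 2 ^ n * (2 * t ² + degreeSum G + Δ)
      t*2ⁿD≤4t∑φ+2ⁿloss = begin
        t * (P * D)                                   ≡⟨ cong (t *_) (sym ∑ₛ-cutWithout) ⟩
        t * (4 * Y)                                   ≡⟨ *-comm-middle t 4 Y ⟩
        4 * t * Y                                     ≡⟨ sym (sumOver-*ˡ (allSubsets n) (4 * t) (cutWithout G u)) ⟩
        ∑ₛ n (λ S → 4 * t * cutWithout G u S)         ≤⟨ sumOver-mono-≤ (allSubsets n) 4t*cutWithout≤4t*φ+loss ⟩
        ∑ₛ n (λ S → 4 * t * φ G S + loss S)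
          ≡⟨ sumOver-distrib-+ (allSubsets n) (λ S → 4 * t * φ G S) loss ⟩
        ∑ₛ n (λ S → 4 * t * φ G S) + ∑ₛ n loss
          ≡⟨ cong₂ _+_ (sumOver-*ˡ (allSubsets n) (4 * t) (φ G)) ∑ₛ-loss ⟩
        4 * t * T + P * (2 * t ² + degreeSum G + Δ)   ∎
        where
        open ≤-Reasoning
        P = 2 ^ n
        Y = ∑ₛ n (cutWithout G u)
        loss : Subset n → ℕ
        loss S = 2 * t ² + ∑[ v < n ] deviation² G S v + deviation² G S u
        *-comm-middle : ∀ t a y → t * (a * y) ≡ a * t * y
        *-comm-middle = solve-∀
        collect : ∀ p a b c → p * a + p * b + p * c ≡ p * (a + b + c)
        collect = solve-∀
        ∑ₛ-loss : ∑ₛ n loss ≡ P * (2 * t ² + degreeSum G + Δ)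
        ∑ₛ-loss = begin-equality
          ∑ₛ n loss
            ≡⟨ sumOver-distrib-+ (allSubsets n) (λ S → 2 * t ² + ∑[ v < n ] deviation² G S v)
                                                (λ S → deviation² G S u) ⟩
          ∑ₛ n (λ S → 2 * t ² + ∑[ v < n ] deviation² G S v) + ∑ₛ n (λ S → deviation² G S u)
            ≡⟨ cong (_+ ∑ₛ n (λ S → deviation² G S u))
                    (sumOver-distrib-+ (allSubsets n) (λ _ → 2 * t ²) (λ S → ∑[ v < n ] deviation² G S v)) ⟩
          ∑ₛ n (λ _ → 2 * t ²) + ∑ₛ n (λ S → ∑[ v < n ] deviation² G S v) + ∑ₛ n (λ S → deviation² G S u)
            ≡⟨ cong₂ _+_ (cong₂ _+_ (∑ₛ-const n (2 * t ²)) ∑ₛ-∑deviation²) (∑ₛ-deviation² G u) ⟩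
          P * (2 * t ²) + P * degreeSum G + P * Δ
            ≡⟨ collect P (2 * t ²) (degreeSum G) Δ ⟩
          P * (2 * t ² + degreeSum G + Δ) ∎
          where
          ∑ₛ-∑deviation² : ∑ₛ n (λ S → ∑[ v < n ] deviation² G S v) ≡ P * degreeSum G
          ∑ₛ-∑deviation² = trans (sumOver-∑ (allSubsets n) (deviation² G))
                                 (trans (sum-cong-≗ (∑ₛ-deviation² G)) (∑-*ˡ P (degree G)))

    -- The weight t = 13k makes the AM–GM loss small: k (2t² + 2|E| + Δ) ≤ 2tD, because
    -- 2|E| + Δ = 3Δ + D ≤ 13D and 26k² ≤ D.
    light-vertex-case : ∀ j → (∀ v → degree G v ≤ Δ) → Δ ≤ 4 * D → 26 * (2 + j) * (2 + j) ≤ D →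
                        j * (2 ^ n * D) ≤ 4 * (2 + j) * T
    light-vertex-case j Δ-maximum Δ≤4D 26k²≤D = [2+j]x≤y+2x⇒jx≤y j (*-cancelˡ-≤ t (begin
      t * (k * (P * D))                 ≡⟨ swap t k (P * D) ⟩
      k * (t * (P * D))                 ≤⟨ *-monoʳ-≤ k (t*2ⁿD≤4t∑φ+2ⁿloss Δ-maximum t) ⟩
      k * (4 * t * T + P * R)           ≡⟨ distribute k t T P R ⟩
      t * (4 * k * T) + P * (k * R)     ≤⟨ +-monoʳ-≤ (t * (4 * k * T)) (*-monoʳ-≤ P kR≤2tD) ⟩
      t * (4 * k * T) + P * (2 * t * D) ≡⟨ factor t k T P D ⟩
      t * (4 * k * T + 2 * (P * D))     ∎))
      where
      open ≤-Reasoning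
      k = 2 + j
      t = 13 * k
      P = 2 ^ n
      R = 2 * t ² + degreeSum G + Δ
      swap : ∀ a b c → a * (b * c) ≡ b * (a * c)
      swap = solve-∀
      distribute : ∀ k t x p r → k * (4 * t * x + p * r) ≡ t * (4 * k * x) + p * (k * r)
      distribute = solve-∀
      factor : ∀ t k x p d → t * (4 * k * x) + p * (2 * t * d) ≡ t * (4 * k * x + 2 * (p * d))
      factor = solve-∀
      expand : ∀ j Δ D → (2 + j) * (2 * ((13 * (2 + j)) * (13 * (2 + j))) + (2 * Δ + D) + Δ)
                         ≡ 26 * (2 + j) * (2 + j) * (13 * (2 + j)) + (2 + j) * (3 * Δ + D)
      expand = solve-∀
      collapse : ∀ j D → D * (13 * (2 + j)) + (2 + j) * (3 * (4 * D) + D) ≡ 2 * (13 * (2 + j)) * D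
      collapse = solve-∀
      kR≤2tD : k * R ≤ 2 * t * D
      kR≤2tD = begin
        k * R                             ≡⟨ cong (λ e → k * (2 * t ² + e + Δ)) (degreeSum-deleteVertex G u) ⟩
        k * (2 * t ² + (2 * Δ + D) + Δ)   ≡⟨ expand j Δ D ⟩
        26 * k * k * t + k * (3 * Δ + D)
          ≤⟨ +-mono-≤ (*-monoˡ-≤ t 26k²≤D) (*-monoʳ-≤ k (+-monoˡ-≤ D (*-monoʳ-≤ 3 Δ≤4D))) ⟩
        D * t + k * (3 * (4 * D) + D)     ≡⟨ collapse j D ⟩
        2 * t * D                         ∎

    ∑φ-lower-bound : ∀ j → Connected G → (∀ v → degree G v ≤ Δ) → 130 * (2 + j) * (2 + j) ≤ m →
                           j * (2 ^ n * maxφ G) ≤ 2 * (2 + j) * T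
    ∑φ-lower-bound j connected Δ-maximum 130k²≤m = *-cancelˡ-≤ 2 (begin
      2 * (j * (P * maxφ G)) ≡⟨ regroup j P (maxφ G) ⟩
      j * (P * (2 * maxφ G)) ≤⟨ *-monoʳ-≤ j (*-monoʳ-≤ P (2*maxφ≤degreeSum-deleteVertex G u)) ⟩
      j * (P * D)            ≤⟨ jPD≤4kT (4 * D ≤? Δ) ⟩
      4 * k * T              ≡⟨ halve k T ⟩
      2 * (2 * k * T)        ∎)
      where
      open ≤-Reasoning
      k = 2 + j
      P = 2 ^ n
      regroup : ∀ j p x → 2 * (j * (p * x)) ≡ j * (p * (2 * x))
      regroup = solve-∀
      halve : ∀ k t → 4 * k * t ≡ 2 * (2 * k * t)
      halve = solve-∀
      m≤Δ+D : m ≤ Δ + D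
      m≤Δ+D = connected⇒m≤degree+degreeSum G connected u
      jPD≤4kT : Dec (4 * D ≤ Δ) → j * (P * D) ≤ 4 * k * T
      jPD≤4kT (yes 4D≤Δ) = heavy-vertex-case j 4D≤Δ (*-cancelˡ-≤ 2 (begin
        2 * (4 * k)     ≡⟨ sym (*-assoc 2 4 k) ⟩
        8 * k           ≤⟨ *-monoˡ-≤ k (m≤m+n 8 122) ⟩
        130 * k         ≤⟨ *-monoʳ-≤ 130 (m≤m*n k k) ⟩
        130 * (k * k)   ≡⟨ sym (*-assoc 130 k k) ⟩
        130 * k * k     ≤⟨ 130k²≤m ⟩
        m               ≤⟨ m≤Δ+D ⟩
        Δ + D           ≤⟨ +-monoʳ-≤ Δ (≤-trans (m≤n*m D 4) 4D≤Δ) ⟩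
        Δ + Δ           ≡⟨ cong (Δ +_) (sym (+-identityʳ Δ)) ⟩
        2 * Δ           ∎))
      jPD≤4kT (no 4D≰Δ) = light-vertex-case j Δ-maximum Δ≤4D (*-cancelˡ-≤ 5 (begin
        5 * (26 * k * k) ≡⟨ scale k ⟩
        130 * k * k      ≤⟨ 130k²≤m ⟩
        m                ≤⟨ m≤Δ+D ⟩
        Δ + D            ≤⟨ +-monoˡ-≤ D Δ≤4D ⟩
        4 * D + D        ≡⟨ +-comm (4 * D) D ⟩
        5 * D            ∎))
        where
        Δ≤4D : Δ ≤ 4 * D
        Δ≤4D = <⇒≤ (≰⇒> 4D≰Δ)
        scale : ∀ k → 5 * (26 * k * k) ≡ 130 * k * k
        scale = solve-∀

open import Data.Nat using (ℕ; _≥_; _+_; suc; s≤s)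
import Data.Nat as ℕ
import Data.Nat.Properties as ℕ
open import Data.Nat.Tactic.RingSolver using (solve-∀)
open import Data.Integer using (+_; -[1+_])
import Data.Integer as ℤ
import Data.Integer.Properties as ℤ
open import Data.Rational using (ℚ; _<_; _≤_; _/_; _-_; _*_; 0ℚ; ½; mkℚ; toℚᵘ; *<*)
import Data.Rational as ℚ
open import Data.Rational.Properties
import Data.Rational.Unnormalised as ℚᵘ
import Data.Rational.Unnormalised.Properties as ℚᵘ
open import Data.Product using (Σ; ∃-syntax; _,_)
open import Relation.Binary.PropositionalEquality using (_≡_; refl; sym; cong)

toℚᵘ-/ : ∀ a b → toℚᵘ (+ a / suc b) ℚᵘ.≃ ℚᵘ.mkℚᵘ (+ a) b
toℚᵘ-/ a b = toℚᵘ-fromℚᵘ (ℚᵘ.mkℚᵘ (+ a) b)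

∃1/[2+j]≤ : ∀ ε → 0ℚ < ε → ∃[ j ] + 1 / (2 + j) ≤ ε
∃1/[2+j]≤ (mkℚ (+ suc a) d _) _ = d , toℚᵘ-cancel-≤ (ℚᵘ.≤-respˡ-≃ (ℚᵘ.≃-sym (toℚᵘ-/ 1 (suc d))) (ℚᵘ.*≤* cross))
  where
  cross : + 1 ℤ.* + suc d ℤ.≤ + suc a ℤ.* + (2 + d)
  cross = ℤ.+≤+ (ℕ.≤-trans (ℕ.≤-reflexive (ℕ.*-identityˡ (suc d)))
                           (ℕ.≤-trans (ℕ.n≤1+n (suc d)) (ℕ.m≤n*m (2 + d) (suc a))))
∃1/[2+j]≤ (mkℚ (+ 0) _ _) (*<* (ℤ.+<+ ()))
∃1/[2+j]≤ (mkℚ -[1+ _ ] _ _) (*<* ())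

-- After cross-multiplication both sides exceed those of the hypothesis by 2M(p + 1).
½M≤T/q+M/[2+j]ᵘ : ∀ j M T p → j ℕ.* (suc p ℕ.* M) ℕ.≤ 2 ℕ.* (2 + j) ℕ.* T →
                  ℚᵘ.mkℚᵘ (+ 1) 1 ℚᵘ.* ℚᵘ.mkℚᵘ (+ M) 0
                  ℚᵘ.≤ ℚᵘ.mkℚᵘ (+ T) p ℚᵘ.+ ℚᵘ.mkℚᵘ (+ 1) (suc j) ℚᵘ.* ℚᵘ.mkℚᵘ (+ M) 0
½M≤T/q+M/[2+j]ᵘ j M T p jqM≤2kT = ℚᵘ.*≤* cross
  where
  k = 2 + j
  cross-ℕ : (1 ℕ.* M) ℕ.* (suc p ℕ.* (k ℕ.* 1)) ℕ.≤ (T ℕ.* (k ℕ.* 1) ℕ.+ (1 ℕ.* M) ℕ.* suc p) ℕ.* (2 ℕ.* 1)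
  cross-ℕ = ℕ.≤-trans (ℕ.≤-reflexive (expand j M p))
              (ℕ.≤-trans (ℕ.+-monoˡ-≤ (2 ℕ.* M ℕ.* suc p) jqM≤2kT) (ℕ.≤-reflexive (collect j M T p)))
    where
    expand : ∀ j M p → (1 ℕ.* M) ℕ.* (suc p ℕ.* ((2 + j) ℕ.* 1)) ≡ j ℕ.* (suc p ℕ.* M) + 2 ℕ.* M ℕ.* suc p
    expand = solve-∀
    collect : ∀ j M T p → 2 ℕ.* (2 + j) ℕ.* T + 2 ℕ.* M ℕ.* suc p
                          ≡ (T ℕ.* ((2 + j) ℕ.* 1) + (1 ℕ.* M) ℕ.* suc p) ℕ.* (2 ℕ.* 1)
    collect = solve-∀
  cross : (+ 1 ℤ.* + M) ℤ.* + (suc p ℕ.* (k ℕ.* 1))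
          ℤ.≤ (+ T ℤ.* + (k ℕ.* 1) ℤ.+ (+ 1 ℤ.* + M) ℤ.* + suc p) ℤ.* + (2 ℕ.* 1)
  cross rewrite sym (ℤ.pos-* 1 M) | sym (ℤ.pos-* (1 ℕ.* M) (suc p ℕ.* (k ℕ.* 1))) | sym (ℤ.pos-* T (k ℕ.* 1))
              | sym (ℤ.pos-* (1 ℕ.* M) (suc p)) | sym (ℤ.pos-+ (T ℕ.* (k ℕ.* 1)) (1 ℕ.* M ℕ.* suc p))
              | sym (ℤ.pos-* (T ℕ.* (k ℕ.* 1) + 1 ℕ.* M ℕ.* suc p) (2 ℕ.* 1)) = ℤ.+≤+ cross-ℕ

½-ε-approximation : ∀ ε j M T q .{{_ : ℕ.NonZero q}} → + 1 / (2 + j) ≤ ε →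
                    j ℕ.* (q ℕ.* M) ℕ.≤ 2 ℕ.* (2 + j) ℕ.* T → (½ - ε) * (+ M / 1) ≤ + T / q
½-ε-approximation ε j M T (suc p) 1/k≤ε jqM≤2kT = begin
  (½ - ε) * M̂                        ≡⟨ *-distribʳ-+ M̂ ½ (ℚ.- ε) ⟩
  ½ * M̂ ℚ.+ ℚ.- ε * M̂               ≡⟨ cong (½ * M̂ ℚ.+_) (sym (neg-distribˡ-* ε M̂)) ⟩
  ½ * M̂ ℚ.+ ℚ.- (ε * M̂)             ≤⟨ +-monoˡ-≤ (ℚ.- (ε * M̂)) ½M̂≤T̂+εM̂ ⟩
  T̂ ℚ.+ ε * M̂ ℚ.+ ℚ.- (ε * M̂)       ≡⟨ +-assoc T̂ (ε * M̂) (ℚ.- (ε * M̂)) ⟩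
  T̂ ℚ.+ (ε * M̂ ℚ.+ ℚ.- (ε * M̂))     ≡⟨ cong (T̂ ℚ.+_) (+-inverseʳ (ε * M̂)) ⟩
  T̂ ℚ.+ 0ℚ                           ≡⟨ +-identityʳ T̂ ⟩
  T̂                                  ∎
  where
  open ≤-Reasoning
  M̂ = + M / 1
  T̂ = + T / suc p
  k̂ = + 1 / (2 + j)
  ½M̂≤T̂+k̂M̂ : ½ * M̂ ≤ T̂ ℚ.+ k̂ * M̂
  ½M̂≤T̂+k̂M̂ = toℚᵘ-cancel-≤ (ℚᵘ.≤-respˡ-≃ (ℚᵘ.≃-sym lhs≃)
                              (ℚᵘ.≤-respʳ-≃ (ℚᵘ.≃-sym rhs≃) (½M≤T/q+M/[2+j]ᵘ j M T p jqM≤2kT)))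
    where
    lhs≃ = ℚᵘ.≃-trans (toℚᵘ-homo-* ½ M̂) (ℚᵘ.*-cong (toℚᵘ-/ 1 1) (toℚᵘ-/ M 0))
    rhs≃ = ℚᵘ.≃-trans (toℚᵘ-homo-+ T̂ (k̂ * M̂))
             (ℚᵘ.+-cong (toℚᵘ-/ T p) (ℚᵘ.≃-trans (toℚᵘ-homo-* k̂ M̂) (ℚᵘ.*-cong (toℚᵘ-/ 1 (suc j)) (toℚᵘ-/ M 0))))
  ½M̂≤T̂+εM̂ : ½ * M̂ ≤ T̂ ℚ.+ ε * M̂
  ½M̂≤T̂+εM̂ = ≤-trans ½M̂≤T̂+k̂M̂ (+-monoʳ-≤ T̂ (*-monoʳ-≤-nonNeg M̂ {{normalize-nonNeg M 1}} 1/k≤ε))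

theorem35 : (ε : ℚ) → 0ℚ < ε → ε < + 1 / 16 →
    Σ ℕ (λ N → (n : ℕ) → n ≥ N → (G : Graph n) → Connected G →
      (½ - ε) * ((+ maxφ G) / 1) ≤ expectedφ G)
theorem35 ε 0<ε _ with ∃1/[2+j]≤ ε 0<ε
... | j , 1/[2+j]≤ε = suc (130 ℕ.* (2 + j) ℕ.* (2 + j)) , λ where
  (suc m) (s≤s 130k²≤m) G connected →
    ½-ε-approximation ε j (maxφ G) (∑ₛ (suc m) (φ G)) (2 ℕ.^ suc m) {{ℕ.m^n≢0 2 (suc m)}} 1/[2+j]≤ε
      (∑φ-lower-bound G (maxDegreeVertex G) j connected (degree≤maxDegree G) 130k²≤m)
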